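{- For the random graph $G(n,p)$, where $0\le p\le 1$, \[ \mathbb{E}\bigl(\mathrm{pn}(G(n,p))\bigr)=\frac12\sum_{k=1}^n\frac{n!}{(n-k)!}\,p^{k-1}+\frac n2 . \]
   Context: $G(n,p)$ is the Erdős–Rényi random graph on $n$ labelled vertices in which each of the $\binom n2$ possible edges is present independently with probability $p$ (with the convention $0^0=1$). For a graph $G$, the subpath number $\mathrm{pn}(G)$ is the number of paths (as subgraphs, i.e. unordered) in $G$, including the trivial paths of length $0$ (single vertices).
   Formalization: The edge probability $p$ ranges over the rationals with $0\le p\le 1$. -}

module Defs where

open import Data.Bool using (Bool; true; false; _∧_; _∨_; not; if_then_else_)
open import Data.Nat as ℕ using (ℕ; zero; suc; _∸_)
open import Data.Fin as Fin using (Fin; toℕ)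
open import Data.List using (List; []; _∷_; map; concatMap; filter; length; foldr; upTo; last)
open import Data.Bool.ListAction using (any)
open import Data.Integer using (+_)
open import Data.List.Base using (allFin)
open import Data.Maybe using (Maybe; just; nothing)
open import Data.Product using (_×_; _,_)
open import Relation.Nullary.Decidable using (⌊_⌋)
open import Data.Rational using (ℚ; 0ℚ; 1ℚ; _+_; _*_; _-_)
import Data.Rational as ℚ

-- Finite simple graphs on the labelled vertex set Fin n.
-- A graph is given by its edge set, a sublist of the list of all
-- vertex pairs (i , j) with i < j (each unordered pair listed once).

pairs : (n : ℕ) → List (Fin n × Fin n)
pairs n = concatMap (λ i → concatMap (λ j → if ⌊ toℕ i ℕ.<? toℕ j ⌋ then (i , j) ∷ [] else []) (allFin n)) (allFin n)

Graph : ℕ → Set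
Graph n = List (Fin n × Fin n)

sublists : {A : Set} → List A → List (List A)
sublists [] = [] ∷ []
sublists (x ∷ xs) = let r = sublists xs in r Data.List.++ map (x ∷_) r

allGraphs : (n : ℕ) → List (Graph n)
allGraphs n = sublists (pairs n)

eqF : {n : ℕ} → Fin n → Fin n → Bool
eqF i j = ⌊ i Fin.≟ j ⌋

adj : {n : ℕ} → Graph n → Fin n → Fin n → Bool
adj G u v = any (λ { (a , b) → (eqF a u ∧ eqF b v) ∨ (eqF a v ∧ eqF b u) }) G

-- A path with k ≥ 1 edges is determined by a sequence
-- v₀ … v_k of distinct vertices with v_{i} v_{i+1} ∈ E(G), up to reversal;
-- we count each such path once via the representative with v₀ < v_k.
-- Trivial paths (single vertices) are the sequences of length 1.

-- all sequences of exactly (suc k) pairwise distinct vertices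
distinctSeqs : (n : ℕ) → ℕ → List (List (Fin n))
distinctSeqs n zero = map (_∷ []) (allFin n)
distinctSeqs n (suc k) =
  concatMap (λ s → concatMap (λ v → if any (eqF v) s then [] else (v ∷ s) ∷ []) (allFin n))
            (distinctSeqs n k)

allDistinctSeqs : (n : ℕ) → List (List (Fin n))
allDistinctSeqs n = concatMap (distinctSeqs n) (upTo n)

consecAdj : {n : ℕ} → Graph n → List (Fin n) → Bool
consecAdj G [] = true
consecAdj G (u ∷ []) = true
consecAdj G (u ∷ v ∷ s) = adj G u v ∧ consecAdj G (v ∷ s)

canonical : {n : ℕ} → List (Fin n) → Bool
canonical [] = false
canonical (u ∷ []) = true
canonical (u ∷ v ∷ s) with last (v ∷ s)
... | just w = ⌊ toℕ u ℕ.<? toℕ w ⌋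
... | nothing = false

isPathSeq : {n : ℕ} → Graph n → List (Fin n) → Bool
isPathSeq G s = consecAdj G s ∧ canonical s

-- pn(G): number of paths (as subgraphs) in G, including trivial ones
pn : {n : ℕ} → Graph n → ℕ
pn {n} G = length (filter (λ s → isPathSeq G s Data.Bool.≟ true) (allDistinctSeqs n))

_^ℚ_ : ℚ → ℕ → ℚ
x ^ℚ zero = 1ℚ
x ^ℚ suc k = x * (x ^ℚ k)

sumℚ : List ℚ → ℚ
sumℚ = foldr _+_ 0ℚ

-- Pr[G(n,p) = G] = p^{e(G)} (1-p)^{C(n,2) - e(G)}   (with 0^0 = 1)
prob : {n : ℕ} → ℚ → Graph n → ℚ
prob {n} p G = (p ^ℚ length G) * ((1ℚ - p) ^ℚ (length (pairs n) ∸ length G))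

expect : (n : ℕ) → ℚ → (Graph n → ℚ) → ℚ
expect n p X = sumℚ (map (λ G → prob p G * X G) (allGraphs n))

toℚ : ℕ → ℚ
toℚ k = (+ k) ℚ./ 1

sumFrom1 : ℕ → (ℕ → ℚ) → ℚ
sumFrom1 zero f = 0ℚ
sumFrom1 (suc n) f = sumFrom1 n f + f (suc n)

module Submission where

-- By linearity of expectation, E pn(G(n,p)) is a sum, over the canonical sequences v₀ … v_k of
-- distinct vertices, of the probability that the k pairs v_i v_{i+1} are all edges; these pairs are
-- distinct, so that probability is p^k. There are n P (k+1) sequences of k + 1 distinct vertices.
-- For k = 0 all n of them are canonical, and for k ≥ 1 exactly half are, because relabelling
-- i ↦ n - 1 - i reverses the order of the labels and so swaps canonical and non-canonical sequences.
-- Hence E pn = n + ½ Σ_{k=2}^n (n P k) p^(k-1), which is the stated formula.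

open import Algebra.Bundles using (CommutativeSemiring; CommutativeRing)
open import Data.Bool using (Bool; true; false; if_then_else_; _∧_; _∨_; T)
import Data.Bool as Bool
open import Data.Bool.ListAction using (any; all)
open import Data.Bool.Properties using (T-∧; T-∨; T-≡)
open import Data.Empty using (⊥-elim)
open import Data.Fin as Fin using (Fin; toℕ; opposite)
import Data.Fin.Permutation as Perm
import Data.Fin.Properties as Fin
open import Data.List using (List; []; _∷_; _++_; map; concatMap; allFin; tabulate; length; filter; last; applyUpTo; upTo)
import Data.List.Properties as List
open import Data.List.Membership.Propositional using (_∈_; _∉_)
open import Data.List.Relation.Unary.All as All using (All; []; _∷_)
open import Data.List.Relation.Unary.All.Properties using (++⁺; map⁺; concat⁺; All¬⇒¬Any; ¬Any⇒All¬)
open import Data.List.Relation.Unary.Any using (here; there)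
open import Data.List.Relation.Unary.Unique.Propositional using (Unique; []; _∷_)
open import Data.Maybe using (just)
open import Data.Nat as ℕ using (ℕ; zero; suc; _∸_; _<_; _≤ᵇ_; z≤n; s≤s)
import Data.Nat.Coprimality as Coprime
open import Data.Nat.Combinatorics using (_P_; nP1≡n)
open import Data.Nat.Combinatorics.Base using (_P′_)
import Data.Nat.Properties as ℕ
open import Data.Integer as ℤ using ()
import Data.Integer.Properties as ℤ
open import Data.Product using (∃; _×_; _,_; proj₁; proj₂)
open import Data.Sum as Sum using (_⊎_; inj₁; inj₂)
open import Function using (_∘_; id)
open import Function.Bundles using (Equivalence)
open import Relation.Nullary using (yes; no)
open import Relation.Nullary.Decidable using (⌊_⌋; toWitness)
open import Relation.Binary.PropositionalEquality as ≡ using (_≡_; _≢_)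
open import Defs

eqF-suc : {n : ℕ} (i j : Fin n) → eqF (Fin.suc i) (Fin.suc j) ≡ eqF i j
eqF-suc i j with i Fin.≟ j
... | yes _ = ≡.refl
... | no _ = ≡.refl

eqF-refl : {n : ℕ} (i : Fin n) → eqF i i ≡ true
eqF-refl i with i Fin.≟ i
... | yes _ = ≡.refl
... | no i≢i = ⊥-elim (i≢i ≡.refl)

eqF-≢ : {n : ℕ} {i j : Fin n} → i ≢ j → eqF i j ≡ false
eqF-≢ {i = i} {j} i≢j with i Fin.≟ j
... | yes i≡j = ⊥-elim (i≢j i≡j)
... | no _ = ≡.refl

module ListSum {c ℓ} (R : CommutativeSemiring c ℓ) where
  open CommutativeSemiring R
  open import Algebra.Properties.CommutativeMonoid.Sum +-commutativeMonoid public
    using (sum-syntax; ∑-distrib-+; ∑-permute; sum-cong-≋; sum-cong-≗; sum-replicate-zero)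
  open import Relation.Binary.Reasoning.Setoid setoid

  sumOver : {X : Set} → (X → Carrier) → List X → Carrier
  sumOver f [] = 0#
  sumOver f (x ∷ xs) = f x + sumOver f xs

  syntax sumOver (λ x → e) xs = ∑[ x ∈ xs ] e

  𝟙 : Bool → Carrier
  𝟙 true = 1#
  𝟙 false = 0#

  𝟙-∧ : ∀ a b → 𝟙 (a ∧ b) ≈ 𝟙 a * 𝟙 b
  𝟙-∧ true b = sym (*-identityˡ (𝟙 b))
  𝟙-∧ false b = sym (zeroˡ (𝟙 b))

  module _ {X : Set} where

    sumOver-cong : {f g : X → Carrier} → (∀ x → f x ≈ g x) → ∀ xs → sumOver f xs ≈ sumOver g xs
    sumOver-cong f≈g [] = refl
    sumOver-cong f≈g (x ∷ xs) = +-cong (f≈g x) (sumOver-cong f≈g xs)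

    sumOver-congᴬ : {f g : X → Carrier} {xs : List X} → All (λ x → f x ≈ g x) xs → sumOver f xs ≈ sumOver g xs
    sumOver-congᴬ [] = refl
    sumOver-congᴬ (fx≈gx ∷ rest) = +-cong fx≈gx (sumOver-congᴬ rest)

    sumOver-++ : (f : X → Carrier) (xs ys : List X) → sumOver f (xs ++ ys) ≈ sumOver f xs + sumOver f ys
    sumOver-++ f [] ys = sym (+-identityˡ _)
    sumOver-++ f (x ∷ xs) ys = trans (+-congˡ (sumOver-++ f xs ys)) (sym (+-assoc _ _ _))

    sumOver-0 : (xs : List X) → ∑[ x ∈ xs ] 0# ≈ 0#
    sumOver-0 [] = refl
    sumOver-0 (x ∷ xs) = trans (+-identityˡ _) (sumOver-0 xs)

    sumOver-distrib-+ : (f g : X → Carrier) (xs : List X) →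
                        ∑[ x ∈ xs ] (f x + g x) ≈ sumOver f xs + sumOver g xs
    sumOver-distrib-+ f g [] = sym (+-identityˡ 0#)
    sumOver-distrib-+ f g (x ∷ xs) = begin
      (f x + g x) + ∑[ y ∈ xs ] (f y + g y)     ≈⟨ +-congˡ (sumOver-distrib-+ f g xs) ⟩
      (f x + g x) + (sumOver f xs + sumOver g xs) ≈⟨ +-assoc _ _ _ ⟩
      f x + (g x + (sumOver f xs + sumOver g xs)) ≈⟨ +-congˡ (x∙yz≈y∙xz _ _ _) ⟩
      f x + (sumOver f xs + (g x + sumOver g xs)) ≈⟨ +-assoc _ _ _ ⟨
      (f x + sumOver f xs) + (g x + sumOver g xs) ∎
      where open import Algebra.Properties.CommutativeSemigroup +-commutativeSemigroup using (x∙yz≈y∙xz)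

    *-distribˡ-sumOver : (a : Carrier) (f : X → Carrier) (xs : List X) →
                         a * sumOver f xs ≈ ∑[ x ∈ xs ] (a * f x)
    *-distribˡ-sumOver a f [] = zeroʳ a
    *-distribˡ-sumOver a f (x ∷ xs) = trans (distribˡ a _ _) (+-congˡ (*-distribˡ-sumOver a f xs))

    *-distribʳ-sumOver : (a : Carrier) (f : X → Carrier) (xs : List X) →
                         sumOver f xs * a ≈ ∑[ x ∈ xs ] (f x * a)
    *-distribʳ-sumOver a f xs = begin
      sumOver f xs * a       ≈⟨ *-comm _ a ⟩
      a * sumOver f xs       ≈⟨ *-distribˡ-sumOver a f xs ⟩
      ∑[ x ∈ xs ] (a * f x) ≈⟨ sumOver-cong (λ x → *-comm a (f x)) xs ⟩
      ∑[ x ∈ xs ] (f x * a) ∎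

  module _ {X Y : Set} where

    sumOver-map : (f : Y → Carrier) (g : X → Y) (xs : List X) → sumOver f (map g xs) ≈ sumOver (f ∘ g) xs
    sumOver-map f g [] = refl
    sumOver-map f g (x ∷ xs) = +-congˡ (sumOver-map f g xs)

    sumOver-concatMap : (f : Y → Carrier) (g : X → List Y) (xs : List X) →
                        sumOver f (concatMap g xs) ≈ ∑[ x ∈ xs ] sumOver f (g x)
    sumOver-concatMap f g [] = refl
    sumOver-concatMap f g (x ∷ xs) =
      trans (sumOver-++ f (g x) (concatMap g xs)) (+-congˡ (sumOver-concatMap f g xs))

    sumOver-comm : (f : X → Y → Carrier) (xs : List X) (ys : List Y) →
                   ∑[ x ∈ xs ] ∑[ y ∈ ys ] f x y ≈ ∑[ y ∈ ys ] ∑[ x ∈ xs ] f x y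
    sumOver-comm f [] ys = sym (sumOver-0 ys)
    sumOver-comm f (x ∷ xs) ys = begin
      sumOver (f x) ys + ∑[ x′ ∈ xs ] ∑[ y ∈ ys ] f x′ y ≈⟨ +-congˡ (sumOver-comm f xs ys) ⟩
      sumOver (f x) ys + ∑[ y ∈ ys ] ∑[ x′ ∈ xs ] f x′ y ≈⟨ sumOver-distrib-+ (f x) _ ys ⟨
      ∑[ y ∈ ys ] (f x y + ∑[ x′ ∈ xs ] f x′ y)          ∎

  sumOver-tabulate : {X : Set} {n : ℕ} (f : X → Carrier) (g : Fin n → X) →
                     sumOver f (tabulate g) ≈ ∑[ i < n ] f (g i)
  sumOver-tabulate {n = zero} f g = refl
  sumOver-tabulate {n = suc n} f g = +-congˡ (sumOver-tabulate f (g ∘ Fin.suc))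

  sumOver-allFin : (n : ℕ) (f : Fin n → Carrier) → sumOver f (allFin n) ≈ ∑[ i < n ] f i
  sumOver-allFin n f = sumOver-tabulate f id

  ∑-if-eqF : {n : ℕ} (j : Fin n) (f : Fin n → Carrier) → ∑[ i < n ] (if eqF i j then f i else 0#) ≈ f j
  ∑-if-eqF {suc n} Fin.zero f = trans (+-congˡ (sum-replicate-zero n)) (+-identityʳ _)
  ∑-if-eqF {suc n} (Fin.suc j) f = begin
    0# + ∑[ i < n ] (if eqF (Fin.suc i) (Fin.suc j) then f (Fin.suc i) else 0#)
      ≈⟨ +-identityˡ _ ⟩
    ∑[ i < n ] (if eqF (Fin.suc i) (Fin.suc j) then f (Fin.suc i) else 0#)
      ≡⟨ sum-cong-≗ (λ i → ≡.cong (λ b → if b then f (Fin.suc i) else 0#) (eqF-suc i j)) ⟩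
    ∑[ i < n ] (if eqF i j then f (Fin.suc i) else 0#)
      ≈⟨ ∑-if-eqF j (f ∘ Fin.suc) ⟩
    f (Fin.suc j) ∎

  ∑∑-if-eqF : {n : ℕ} (a b : Fin n) (c : Carrier) →
              ∑[ i < n ] ∑[ j < n ] (if eqF i a then (if eqF j b then c else 0#) else 0#) ≈ c
  ∑∑-if-eqF {n} a b c = trans (sum-cong-≋ inner) (∑-if-eqF a (λ _ → c))
    where
    inner : (i : Fin n) →
            ∑[ j < n ] (if eqF i a then (if eqF j b then c else 0#) else 0#) ≈ (if eqF i a then c else 0#)
    inner i with eqF i a
    ... | true = ∑-if-eqF b (λ _ → c)
    ... | false = sum-replicate-zero n

-- Opened only after ListSum, whose body has the semiring's own refl, sym, trans, _+_ and _*_ in scope.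
open ≡ using (refl; sym; trans; cong; cong₂; subst; subst₂; module ≡-Reasoning)
open import Data.Rational using (ℚ; mkℚ; 0ℚ; 1ℚ; ½; _+_; _*_; _-_; -_; _≤_)
import Data.Rational.Properties as ℚ
open import Data.Rational.Solver using (module +-*-Solver)

module ℕ∑ = ListSum ℕ.+-*-commutativeSemiring
module ℚ∑ = ListSum (CommutativeRing.commutativeSemiring ℚ.+-*-commutativeRing)

sublists-length≤ : {A : Set} (L : List A) → All (λ G → length G ℕ.≤ length L) (sublists L)
sublists-length≤ [] = z≤n ∷ []
sublists-length≤ (x ∷ xs) =
  ++⁺ (All.map ℕ.m≤n⇒m≤1+n (sublists-length≤ xs)) (map⁺ (All.map s≤s (sublists-length≤ xs)))

module Coverage {X Y : Set} (covers : Y → X → Bool) where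

  allCovered : List Y → List X → Bool
  allCovered R G = all (λ r → any (covers r) G) R

  dropCoveredBy : X → List Y → List Y
  dropCoveredBy x [] = []
  dropCoveredBy x (r ∷ R) = if covers r x then dropCoveredBy x R else r ∷ dropCoveredBy x R

  #coverers : List X → Y → ℕ
  #coverers L r = ℕ∑.∑[ x ∈ L ] ℕ∑.𝟙 (covers r x)

  #coveredBy : List Y → X → ℕ
  #coveredBy R x = ℕ∑.∑[ r ∈ R ] ℕ∑.𝟙 (covers r x)

  allCovered-∷ : (x : X) (R : List Y) (G : List X) → allCovered R (x ∷ G) ≡ allCovered (dropCoveredBy x R) G
  allCovered-∷ x [] G = refl
  allCovered-∷ x (r ∷ R) G with covers r x
  ... | true = allCovered-∷ x R G
  ... | false = cong (any (covers r) G ∧_) (allCovered-∷ x R G)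

  ∈-dropCoveredBy : {x : X} {r : Y} {R : List Y} → covers r x ≡ false → r ∈ R → r ∈ dropCoveredBy x R
  ∈-dropCoveredBy {x} miss (here refl) rewrite miss = here refl
  ∈-dropCoveredBy {x} {R = r′ ∷ R} miss (there r∈R) with covers r′ x
  ... | true = ∈-dropCoveredBy miss r∈R
  ... | false = there (∈-dropCoveredBy miss r∈R)

  All-dropCoveredBy : {Q : Y → Set} (x : X) {R : List Y} → All Q R →
                      All (λ r → covers r x ≡ false × Q r) (dropCoveredBy x R)
  All-dropCoveredBy x [] = []
  All-dropCoveredBy x {r ∷ R} (qr ∷ qrs) with covers r x in miss
  ... | true = All-dropCoveredBy x qrs
  ... | false = (miss , qr) ∷ All-dropCoveredBy x qrs

  dropCoveredBy-missed : (x : X) {R : List Y} → All (λ r → covers r x ≡ false) R → dropCoveredBy x R ≡ R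
  dropCoveredBy-missed x [] = refl
  dropCoveredBy-missed x {r ∷ R} (miss ∷ misses) rewrite miss = cong (r ∷_) (dropCoveredBy-missed x misses)

  #coveredBy+length-dropCoveredBy : (x : X) (R : List Y) → #coveredBy R x ℕ.+ length (dropCoveredBy x R) ≡ length R
  #coveredBy+length-dropCoveredBy x [] = refl
  #coveredBy+length-dropCoveredBy x (r ∷ R) with covers r x
  ... | true = cong suc (#coveredBy+length-dropCoveredBy x R)
  ... | false = trans (ℕ.+-suc _ _) (cong suc (#coveredBy+length-dropCoveredBy x R))

  #coveredBy-dropCoveredBy : (x y : X) (R : List Y) → #coveredBy (dropCoveredBy x R) y ℕ.≤ #coveredBy R y
  #coveredBy-dropCoveredBy x y [] = z≤n
  #coveredBy-dropCoveredBy x y (r ∷ R) with covers r x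
  ... | true = ℕ.≤-trans (#coveredBy-dropCoveredBy x y R) (ℕ.m≤n+m _ (ℕ∑.𝟙 (covers r y)))
  ... | false = ℕ.+-monoʳ-≤ (ℕ∑.𝟙 (covers r y)) (#coveredBy-dropCoveredBy x y R)

  #coveredBy≡0⇒missed : (x : X) (R : List Y) → #coveredBy R x ≡ 0 → All (λ r → covers r x ≡ false) R
  #coveredBy≡0⇒missed x [] _ = []
  #coveredBy≡0⇒missed x (r ∷ R) none with covers r x in miss
  ... | false = miss ∷ #coveredBy≡0⇒missed x R none

  missed⇒#coveredBy≡0 : (x : X) {R : List Y} → All (λ r → covers r x ≡ false) R → #coveredBy R x ≡ 0
  missed⇒#coveredBy≡0 x [] = refl
  missed⇒#coveredBy≡0 x (miss ∷ misses) rewrite miss = missed⇒#coveredBy≡0 x misses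

  #coveredBy≢0⇒covered : (x : X) (R : List Y) {k : ℕ} → #coveredBy R x ≡ suc k →
                         ∃ λ r → r ∈ R × covers r x ≡ true
  #coveredBy≢0⇒covered x (r ∷ R) some with covers r x in hit
  ... | true = r , here refl , hit
  ... | false = let r′ , r′∈R , hit′ = #coveredBy≢0⇒covered x R some in r′ , there r′∈R , hit′

  #coverers-∷-missed : (x : X) (L : List X) {r : Y} → covers r x ≡ false → #coverers (x ∷ L) r ≡ #coverers L r
  #coverers-∷-missed x L miss rewrite miss = refl

  #coverers-∷≡0 : (x : X) (L : List X) (r : Y) → #coverers (x ∷ L) r ≡ 0 → covers r x ≡ false × #coverers L r ≡ 0
  #coverers-∷≡0 x L r none with covers r x
  ... | false = refl , none

  -- Each element of L is kept independently with probability p; coverProb L R is the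
  -- probability that every requirement in R is covered by some kept element.
  module _ (p : ℚ) where
    open ℚ∑ using (sumOver; 𝟙; sumOver-++; sumOver-map; sumOver-cong; sumOver-congᴬ; *-distribˡ-sumOver)
    open ≡-Reasoning

    q : ℚ
    q = 1ℚ - p

    subsetProb : List X → List X → ℚ
    subsetProb L G = (p ^ℚ length G) * (q ^ℚ (length L ∸ length G))

    coverProb : List X → List Y → ℚ
    coverProb L R = ℚ∑.∑[ G ∈ sublists L ] (subsetProb L G * 𝟙 (allCovered R G))

    subsetProb-∷-out : (x : X) (L G : List X) → length G ℕ.≤ length L → subsetProb (x ∷ L) G ≡ q * subsetProb L G
    subsetProb-∷-out x L G G≤L = begin
      pᴳ * (q ^ℚ (suc (length L) ∸ length G)) ≡⟨ cong (λ k → pᴳ * (q ^ℚ k)) (ℕ.+-∸-assoc 1 G≤L) ⟩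
      pᴳ * (q * qᴸ⁻ᴳ)                          ≡⟨ ℚ.*-assoc pᴳ q qᴸ⁻ᴳ ⟨
      (pᴳ * q) * qᴸ⁻ᴳ                          ≡⟨ cong (_* qᴸ⁻ᴳ) (ℚ.*-comm pᴳ q) ⟩
      (q * pᴳ) * qᴸ⁻ᴳ                          ≡⟨ ℚ.*-assoc q pᴳ qᴸ⁻ᴳ ⟩
      q * subsetProb L G                       ∎
      where
      pᴳ = p ^ℚ length G
      qᴸ⁻ᴳ = q ^ℚ (length L ∸ length G)

    coverProb-∷ : (x : X) (L : List X) (R : List Y) →
                  coverProb (x ∷ L) R ≡ q * coverProb L R + p * coverProb L (dropCoveredBy x R)
    coverProb-∷ x L R = begin
      coverProb (x ∷ L) R
        ≡⟨ sumOver-++ term (sublists L) (map (x ∷_) (sublists L)) ⟩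
      sumOver term (sublists L) + sumOver term (map (x ∷_) (sublists L))
        ≡⟨ cong₂ _+_ (sumOver-congᴬ (All.map (λ {G} → without-x {G}) (sublists-length≤ L)))
                     (trans (sumOver-map term (x ∷_) (sublists L)) (sumOver-cong with-x (sublists L))) ⟩
      ℚ∑.∑[ G ∈ sublists L ] (q * (subsetProb L G * 𝟙 (allCovered R G)))
        + ℚ∑.∑[ G ∈ sublists L ] (p * (subsetProb L G * 𝟙 (allCovered (dropCoveredBy x R) G)))
        ≡⟨ cong₂ _+_ (*-distribˡ-sumOver q _ (sublists L)) (*-distribˡ-sumOver p _ (sublists L)) ⟨
      q * coverProb L R + p * coverProb L (dropCoveredBy x R) ∎
      where
      term : List X → ℚ
      term G = subsetProb (x ∷ L) G * 𝟙 (allCovered R G)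
      without-x : {G : List X} → length G ℕ.≤ length L → term G ≡ q * (subsetProb L G * 𝟙 (allCovered R G))
      without-x {G} G≤L =
        trans (cong (_* 𝟙 (allCovered R G)) (subsetProb-∷-out x L G G≤L)) (ℚ.*-assoc q _ _)
      with-x : (G : List X) → term (x ∷ G) ≡ p * (subsetProb L G * 𝟙 (allCovered (dropCoveredBy x R) G))
      with-x G = trans (cong₂ _*_ (ℚ.*-assoc p _ _) (cong 𝟙 (allCovered-∷ x R G))) (ℚ.*-assoc p _ _)

    coverProb-uncoverable : (L : List X) {R : List Y} {r : Y} → r ∈ R → #coverers L r ≡ 0 → coverProb L R ≡ 0ℚ
    coverProb-uncoverable [] {_ ∷ _} _ _ = refl
    coverProb-uncoverable (x ∷ L) {R} {r} r∈R none = begin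
      coverProb (x ∷ L) R
        ≡⟨ coverProb-∷ x L R ⟩
      q * coverProb L R + p * coverProb L (dropCoveredBy x R)
        ≡⟨ cong₂ (λ a b → q * a + p * b) (coverProb-uncoverable L r∈R none′)
                                          (coverProb-uncoverable L (∈-dropCoveredBy miss r∈R) none′) ⟩
      q * 0ℚ + p * 0ℚ
        ≡⟨ cong₂ _+_ (ℚ.*-zeroʳ q) (ℚ.*-zeroʳ p) ⟩
      0ℚ ∎
      where
      miss = proj₁ (#coverers-∷≡0 x L r none)
      none′ = proj₂ (#coverers-∷≡0 x L r none)

    coverProb-∷-useless : (x : X) (L : List X) (R : List Y) → #coveredBy R x ≡ 0 → coverProb (x ∷ L) R ≡ coverProb L R
    coverProb-∷-useless x L R none = begin
      coverProb (x ∷ L) R                                     ≡⟨ coverProb-∷ x L R ⟩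
      q * coverProb L R + p * coverProb L (dropCoveredBy x R) ≡⟨ cong (λ R′ → q * π + p * coverProb L R′) dropped ⟩
      q * π + p * π                                           ≡⟨ ℚ.*-distribʳ-+ π q p ⟨
      (q + p) * π                                             ≡⟨ cong (_* π) q+p≡1 ⟩
      1ℚ * π                                                  ≡⟨ ℚ.*-identityˡ π ⟩
      π                                                       ∎
      where
      π = coverProb L R
      dropped = dropCoveredBy-missed x (#coveredBy≡0⇒missed x R none)
      q+p≡1 : q + p ≡ 1ℚ
      q+p≡1 = trans (ℚ.+-assoc 1ℚ (- p) p) (trans (cong (1ℚ +_) (ℚ.+-inverseˡ p)) (ℚ.+-identityʳ 1ℚ))

    coverProb-∷-essential : (x : X) (L : List X) {R : List Y} {r : Y} → r ∈ R → #coverers L r ≡ 0 →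
                            coverProb (x ∷ L) R ≡ p * coverProb L (dropCoveredBy x R)
    coverProb-∷-essential x L {R} r∈R none = begin
      coverProb (x ∷ L) R                ≡⟨ coverProb-∷ x L R ⟩
      q * coverProb L R + p * π          ≡⟨ cong (λ a → q * a + p * π) (coverProb-uncoverable L r∈R none) ⟩
      q * 0ℚ + p * π                     ≡⟨ cong (_+ p * π) (ℚ.*-zeroʳ q) ⟩
      0ℚ + p * π                         ≡⟨ ℚ.+-identityˡ (p * π) ⟩
      p * π                              ∎
      where
      π = coverProb L (dropCoveredBy x R)

    coverProb-exactCover : (L : List X) (R : List Y) → All (λ r → #coverers L r ≡ 1) R →
                           All (λ x → #coveredBy R x ℕ.≤ 1) L → coverProb L R ≡ p ^ℚ length R
    coverProb-exactCover [] [] _ _ = refl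
    coverProb-exactCover [] (r ∷ R) (() ∷ _) _
    coverProb-exactCover (x ∷ L) R once (x≤1 ∷ atMostOnce) with #coveredBy R x in covered | x≤1
    ... | suc (suc _) | s≤s ()
    ... | 0 | _ = trans (coverProb-∷-useless x L R covered) (coverProb-exactCover L R once′ atMostOnce)
      where
      once′ : All (λ r → #coverers L r ≡ 1) R
      once′ = All.zipWith (λ (miss , one) → trans (sym (#coverers-∷-missed x L miss)) one)
                          (#coveredBy≡0⇒missed x R covered , once)
    ... | 1 | _ with #coveredBy≢0⇒covered x R covered
    ...   | r , r∈R , hit = begin
      coverProb (x ∷ L) R                   ≡⟨ coverProb-∷-essential x L r∈R none ⟩
      p * coverProb L (dropCoveredBy x R)   ≡⟨ cong (p *_) ih ⟩
      p ^ℚ suc (length (dropCoveredBy x R)) ≡⟨ cong (p ^ℚ_) shorter ⟩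
      p ^ℚ length R                         ∎
      where
      none : #coverers L r ≡ 0
      none = ℕ.suc-injective (trans (cong (λ b → ℕ∑.𝟙 b ℕ.+ #coverers L r) (sym hit)) (All.lookup once r∈R))
      shorter : suc (length (dropCoveredBy x R)) ≡ length R
      shorter = trans (cong (ℕ._+ length (dropCoveredBy x R)) (sym covered)) (#coveredBy+length-dropCoveredBy x R)
      ih = coverProb-exactCover L (dropCoveredBy x R)
             (All.map (λ (miss , one) → trans (sym (#coverers-∷-missed x L miss)) one) (All-dropCoveredBy x once))
             (All.map (λ {y} → ℕ.≤-trans (#coveredBy-dropCoveredBy x y R)) atMostOnce)

open ℕ∑ using (sumOver; sum-syntax; 𝟙; sum-cong-≗; sum-replicate-zero; sumOver-cong; sumOver-congᴬ; sumOver-map;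
               sumOver-concatMap; sumOver-distrib-+; sumOver-allFin; ∑-distrib-+; ∑-permute; ∑-if-eqF; ∑∑-if-eqF)

∉⇒any-eqF≡false : {n : ℕ} {v : Fin n} (s : List (Fin n)) → v ∉ s → any (eqF v) s ≡ false
∉⇒any-eqF≡false [] _ = refl
∉⇒any-eqF≡false {v = v} (w ∷ s) v∉ with v Fin.≟ w
... | yes v≡w = ⊥-elim (v∉ (here v≡w))
... | no _ = ∉⇒any-eqF≡false s (v∉ ∘ there)

any-eqF≡false⇒∉ : {n : ℕ} {v : Fin n} (s : List (Fin n)) → any (eqF v) s ≡ false → v ∉ s
any-eqF≡false⇒∉ {v = v} (w ∷ s) none (here refl) rewrite eqF-refl v with none
... | ()
any-eqF≡false⇒∉ {v = v} (w ∷ s) none (there v∈s) with eqF v w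
... | false = any-eqF≡false⇒∉ s none v∈s

length-concatMap : {A B : Set} (f : A → List B) (xs : List A) → length (concatMap f xs) ≡ ∑[ x ∈ xs ] length (f x)
length-concatMap f [] = refl
length-concatMap f (x ∷ xs) = trans (List.length-++ (f x)) (cong (length (f x) ℕ.+_) (length-concatMap f xs))

sumOver-const : {A : Set} (c : ℕ) (xs : List A) → ∑[ x ∈ xs ] c ≡ length xs ℕ.* c
sumOver-const c [] = refl
sumOver-const c (x ∷ xs) = cong (c ℕ.+_) (sumOver-const c xs)

nP′k≡0 : {n k : ℕ} → n < k → n P′ k ≡ 0
nP′k≡0 {n} {suc k} (s≤s n≤k) with ℕ.m≤n⇒m<n∨m≡n n≤k
... | inj₁ n<k = trans (cong ((n ∸ k) ℕ.*_) (nP′k≡0 n<k)) (ℕ.*-zeroʳ (n ∸ k))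
... | inj₂ refl = cong (ℕ._* (n P′ n)) (ℕ.n∸n≡0 n)

nPk≡nP′k : (n k : ℕ) → n P k ≡ n P′ k
nPk≡nP′k n k with k ≤ᵇ n in k≤ᵇn
... | true = refl
... | false = sym (nP′k≡0 {n} {k} (ℕ.≰⇒> (λ k≤n → subst T k≤ᵇn (ℕ.≤⇒≤ᵇ k≤n))))

module DistinctSeqs (n : ℕ) where

  extend : List (Fin n) → Fin n → List (List (Fin n))
  extend s v = if any (eqF v) s then [] else (v ∷ s) ∷ []

  distinctSeqs-unique : (k : ℕ) → All (λ s → Unique s × length s ≡ suc k) (distinctSeqs n k)
  distinctSeqs-unique zero = map⁺ (All.universal (λ v → ([] ∷ []) , refl) (allFin n))
  distinctSeqs-unique (suc k) =
    concat⁺ (map⁺ (All.map (λ {s} inv → concat⁺ (map⁺ (All.universal (extend-unique s inv) (allFin n))))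
                           (distinctSeqs-unique k)))
    where
    extend-unique : (s : List (Fin n)) → Unique s × length s ≡ suc k → (v : Fin n) →
                    All (λ s′ → Unique s′ × length s′ ≡ suc (suc k)) (extend s v)
    extend-unique s (uniq , len) v with any (eqF v) s in v∉s
    ... | true = []
    ... | false = ((¬Any⇒All¬ s (any-eqF≡false⇒∉ s v∉s) ∷ uniq) , cong suc len) ∷ []

  ∑-1 : ∑[ v < n ] 1 ≡ n
  ∑-1 = go n
    where
    go : (m : ℕ) → ∑[ v < m ] 1 ≡ m
    go zero = refl
    go (suc m) = cong suc (go m)

  ∑-member : (s : List (Fin n)) → Unique s → ∑[ v < n ] 𝟙 (any (eqF v) s) ≡ length s
  ∑-member [] _ = sum-replicate-zero n
  ∑-member (w ∷ s) (w∉s ∷ uniq) = begin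
    ∑[ v < n ] 𝟙 (eqF v w ∨ any (eqF v) s)
      ≡⟨ sum-cong-≗ split ⟩
    ∑[ v < n ] ((if eqF v w then 1 else 0) ℕ.+ 𝟙 (any (eqF v) s))
      ≡⟨ ∑-distrib-+ {n} _ _ ⟩
    ∑[ v < n ] (if eqF v w then 1 else 0) ℕ.+ ∑[ v < n ] 𝟙 (any (eqF v) s)
      ≡⟨ cong₂ ℕ._+_ (∑-if-eqF w (λ _ → 1)) (∑-member s uniq) ⟩
    suc (length s) ∎
    where
    open ≡-Reasoning
    split : (v : Fin n) → 𝟙 (eqF v w ∨ any (eqF v) s) ≡ (if eqF v w then 1 else 0) ℕ.+ 𝟙 (any (eqF v) s)
    split v with v Fin.≟ w
    ... | yes refl rewrite ∉⇒any-eqF≡false s (All¬⇒¬Any w∉s) = refl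
    ... | no _ = refl

  ∑-nonmember : (s : List (Fin n)) → Unique s → ∑[ v < n ] (if any (eqF v) s then 0 else 1) ≡ n ∸ length s
  ∑-nonmember s uniq = begin
    ∑[ v < n ] out v                                           ≡⟨ ℕ.m+n∸m≡n (∑[ v < n ] in′ v) _ ⟨
    (∑[ v < n ] in′ v ℕ.+ ∑[ v < n ] out v) ∸ ∑[ v < n ] in′ v ≡⟨ cong₂ _∸_ in+out (∑-member s uniq) ⟩
    n ∸ length s                                               ∎
    where
    open ≡-Reasoning
    in′ out : Fin n → ℕ
    in′ v = 𝟙 (any (eqF v) s)
    out v = if any (eqF v) s then 0 else 1
    in+out : ∑[ v < n ] in′ v ℕ.+ ∑[ v < n ] out v ≡ n
    in+out = trans (sym (∑-distrib-+ {n} in′ out)) (trans (sum-cong-≗ (λ v → partition (any (eqF v) s))) ∑-1)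
      where
      partition : (b : Bool) → 𝟙 b ℕ.+ (if b then 0 else 1) ≡ 1
      partition true = refl
      partition false = refl

  length-extensions : (s : List (Fin n)) → Unique s → length (concatMap (extend s) (allFin n)) ≡ n ∸ length s
  length-extensions s uniq = begin
    length (concatMap (extend s) (allFin n))            ≡⟨ length-concatMap (extend s) (allFin n) ⟩
    ∑[ v ∈ allFin n ] length (extend s v)               ≡⟨ sumOver-allFin n _ ⟩
    ∑[ v < n ] length (extend s v)                      ≡⟨ sum-cong-≗ length-extend ⟩
    ∑[ v < n ] (if any (eqF v) s then 0 else 1)         ≡⟨ ∑-nonmember s uniq ⟩
    n ∸ length s                                        ∎
    where
    open ≡-Reasoning
    length-extend : (v : Fin n) → length (extend s v) ≡ (if any (eqF v) s then 0 else 1)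
    length-extend v with any (eqF v) s
    ... | true = refl
    ... | false = refl

  length-distinctSeqs : (k : ℕ) → length (distinctSeqs n k) ≡ n P suc k
  length-distinctSeqs zero =
    trans (List.length-map _ (allFin n)) (trans (List.length-tabulate id) (sym (nP1≡n n)))
  length-distinctSeqs (suc k) = begin
    length (concatMap (λ s → concatMap (extend s) (allFin n)) (distinctSeqs n k))
      ≡⟨ length-concatMap _ (distinctSeqs n k) ⟩
    ∑[ s ∈ distinctSeqs n k ] length (concatMap (extend s) (allFin n))
      ≡⟨ sumOver-congᴬ (All.map (λ {s} (uniq , len) → trans (length-extensions s uniq) (cong (n ∸_) len))
                                (distinctSeqs-unique k)) ⟩
    ∑[ s ∈ distinctSeqs n k ] (n ∸ suc k)
      ≡⟨ sumOver-const (n ∸ suc k) (distinctSeqs n k) ⟩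
    length (distinctSeqs n k) ℕ.* (n ∸ suc k)
      ≡⟨ cong (ℕ._* (n ∸ suc k)) (trans (length-distinctSeqs k) (nPk≡nP′k n (suc k))) ⟩
    (n P′ suc k) ℕ.* (n ∸ suc k)
      ≡⟨ trans (ℕ.*-comm (n P′ suc k) (n ∸ suc k)) (sym (nPk≡nP′k n (suc (suc k)))) ⟩
    n P suc (suc k) ∎
    where open ≡-Reasoning

lastOf : {A : Set} → A → List A → A
lastOf v [] = v
lastOf v (w ∷ t) = lastOf w t

last≡lastOf : {A : Set} (v : A) (t : List A) → last (v ∷ t) ≡ just (lastOf v t)
last≡lastOf v [] = refl
last≡lastOf v (w ∷ t) = last≡lastOf w t

lastOf-∈ : {A : Set} (v : A) (t : List A) → lastOf v t ∈ v ∷ t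
lastOf-∈ v [] = here refl
lastOf-∈ v (w ∷ t) = there (lastOf-∈ w t)

lastOf-map : {A B : Set} (f : A → B) (v : A) (t : List A) → lastOf (f v) (map f t) ≡ f (lastOf v t)
lastOf-map f v [] = refl
lastOf-map f v (w ∷ t) = lastOf-map f w t

canonical-∷∷ : {n : ℕ} (u v : Fin n) (t : List (Fin n)) → canonical (u ∷ v ∷ t) ≡ ⌊ toℕ u ℕ.<? toℕ (lastOf v t) ⌋
canonical-∷∷ u v t rewrite last≡lastOf v t = refl

<-xor-> : {n : ℕ} (u v : Fin n) → u ≢ v → 𝟙 ⌊ toℕ u ℕ.<? toℕ v ⌋ ℕ.+ 𝟙 ⌊ toℕ v ℕ.<? toℕ u ⌋ ≡ 1
<-xor-> u v u≢v with toℕ u ℕ.<? toℕ v | toℕ v ℕ.<? toℕ u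
... | yes _ | no _ = refl
... | no _ | yes _ = refl
... | yes u<v | yes v<u = ⊥-elim (ℕ.<-asym u<v v<u)
... | no u≮v | no v≮u = ⊥-elim (u≢v (Fin.toℕ-injective (ℕ.≤-antisym (ℕ.≮⇒≥ v≮u) (ℕ.≮⇒≥ u≮v))))

opposite-<-reverse : {n : ℕ} {i j : Fin n} → toℕ i < toℕ j → toℕ (opposite j) < toℕ (opposite i)
opposite-<-reverse {n} {i} {j} i<j =
  subst₂ _<_ (sym (Fin.opposite-prop j)) (sym (Fin.opposite-prop i)) (ℕ.∸-monoʳ-< (s≤s i<j) (Fin.toℕ<n j))

<?-opposite : {n : ℕ} (i j : Fin n) → ⌊ toℕ (opposite i) ℕ.<? toℕ (opposite j) ⌋ ≡ ⌊ toℕ j ℕ.<? toℕ i ⌋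
<?-opposite i j with toℕ (opposite i) ℕ.<? toℕ (opposite j) | toℕ j ℕ.<? toℕ i
... | yes _ | yes _ = refl
... | no _ | no _ = refl
... | yes i′<j′ | no j≮i =
  ⊥-elim (j≮i (subst₂ _<_ (cong toℕ (Fin.opposite-involutive j)) (cong toℕ (Fin.opposite-involutive i))
                          (opposite-<-reverse i′<j′)))
... | no i′≮j′ | yes j<i = ⊥-elim (i′≮j′ (opposite-<-reverse j<i))

eqF-opposite : {n : ℕ} (v w : Fin n) → eqF (opposite v) (opposite w) ≡ eqF v w
eqF-opposite v w with v Fin.≟ w
... | yes refl = eqF-refl (opposite v)
... | no v≢w = eqF-≢ (λ v′≡w′ → v≢w (trans (sym (Fin.opposite-involutive v))
                                           (trans (cong opposite v′≡w′) (Fin.opposite-involutive w))))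

any-eqF-opposite : {n : ℕ} (v : Fin n) (s : List (Fin n)) → any (eqF (opposite v)) (map opposite s) ≡ any (eqF v) s
any-eqF-opposite v [] = refl
any-eqF-opposite v (w ∷ s) = cong₂ _∨_ (eqF-opposite v w) (any-eqF-opposite v s)

module CanonicalSeqs (n : ℕ) where
  open DistinctSeqs n

  #canonical : ℕ → ℕ
  #canonical k = ∑[ s ∈ distinctSeqs n k ] 𝟙 (canonical s)

  #canonical-0 : #canonical 0 ≡ n
  #canonical-0 = trans (sumOver-map _ _ (allFin n)) (trans (sumOver-allFin n _) ∑-1)

  sumOver-distinctSeqs-opposite : (k : ℕ) (g : List (Fin n) → ℕ) →
    ∑[ s ∈ distinctSeqs n k ] g (map opposite s) ≡ ∑[ s ∈ distinctSeqs n k ] g s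
  sumOver-distinctSeqs-opposite zero g = begin
    ∑[ s ∈ map (_∷ []) (allFin n) ] g (map opposite s) ≡⟨ trans (sumOver-map _ _ (allFin n)) (sumOver-allFin n _) ⟩
    ∑[ v < n ] g (opposite v ∷ [])                    ≡⟨ ∑-permute (λ v → g (v ∷ [])) Perm.reverse ⟨
    ∑[ v < n ] g (v ∷ [])                             ≡⟨ trans (sumOver-map _ _ (allFin n)) (sumOver-allFin n _) ⟨
    ∑[ s ∈ map (_∷ []) (allFin n) ] g s               ∎
    where open ≡-Reasoning
  sumOver-distinctSeqs-opposite (suc k) g = begin
    ∑[ s ∈ distinctSeqs n (suc k) ] g (map opposite s)
      ≡⟨ sumOver-concatMap _ _ (distinctSeqs n k) ⟩
    ∑[ s ∈ distinctSeqs n k ] ∑[ s′ ∈ extensions s ] g (map opposite s′)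
      ≡⟨ sumOver-cong reflect (distinctSeqs n k) ⟩
    ∑[ s ∈ distinctSeqs n k ] h (map opposite s)
      ≡⟨ sumOver-distinctSeqs-opposite k h ⟩
    ∑[ s ∈ distinctSeqs n k ] h s
      ≡⟨ sumOver-cong (λ s → sym (sumOver-extensions g s)) (distinctSeqs n k) ⟩
    ∑[ s ∈ distinctSeqs n k ] ∑[ s′ ∈ extensions s ] g s′
      ≡⟨ sumOver-concatMap _ _ (distinctSeqs n k) ⟨
    ∑[ s ∈ distinctSeqs n (suc k) ] g s ∎
    where
    open ≡-Reasoning
    extensions : List (Fin n) → List (List (Fin n))
    extensions s = concatMap (extend s) (allFin n)
    h : List (Fin n) → ℕ
    h t = ∑[ v < n ] sumOver g (extend t v)
    sumOver-extensions : (f : List (Fin n) → ℕ) (s : List (Fin n)) →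
                         sumOver f (extensions s) ≡ ∑[ v < n ] sumOver f (extend s v)
    sumOver-extensions f s = trans (sumOver-concatMap _ _ (allFin n)) (sumOver-allFin n _)
    extend-opposite : (s : List (Fin n)) (v : Fin n) →
                      sumOver (g ∘ map opposite) (extend s v) ≡ sumOver g (extend (map opposite s) (opposite v))
    extend-opposite s v rewrite any-eqF-opposite v s with any (eqF v) s
    ... | true = refl
    ... | false = refl
    reflect : (s : List (Fin n)) → ∑[ s′ ∈ extensions s ] g (map opposite s′) ≡ h (map opposite s)
    reflect s = trans (sumOver-extensions _ s)
                  (trans (sum-cong-≗ (extend-opposite s))
                         (sym (∑-permute (λ v → sumOver g (extend (map opposite s) v)) Perm.reverse)))

  canonical-xor-opposite : (s : List (Fin n)) → Unique s → 2 ℕ.≤ length s →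
                           𝟙 (canonical s) ℕ.+ 𝟙 (canonical (map opposite s)) ≡ 1
  canonical-xor-opposite (u ∷ []) _ (s≤s ())
  canonical-xor-opposite (u ∷ v ∷ t) (u∉ ∷ _) _ = begin
    𝟙 (canonical (u ∷ v ∷ t)) ℕ.+ 𝟙 (canonical (opposite u ∷ opposite v ∷ map opposite t))
      ≡⟨ cong₂ (λ a b → 𝟙 a ℕ.+ 𝟙 b) (canonical-∷∷ u v t)
           (trans (canonical-∷∷ (opposite u) (opposite v) (map opposite t))
                  (cong (λ w → ⌊ toℕ (opposite u) ℕ.<? toℕ w ⌋) (lastOf-map opposite v t))) ⟩
    𝟙 ⌊ toℕ u ℕ.<? toℕ w ⌋ ℕ.+ 𝟙 ⌊ toℕ (opposite u) ℕ.<? toℕ (opposite w) ⌋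
      ≡⟨ cong (λ b → 𝟙 ⌊ toℕ u ℕ.<? toℕ w ⌋ ℕ.+ 𝟙 b) (<?-opposite u w) ⟩
    𝟙 ⌊ toℕ u ℕ.<? toℕ w ⌋ ℕ.+ 𝟙 ⌊ toℕ w ℕ.<? toℕ u ⌋
      ≡⟨ <-xor-> u w (λ u≡w → All¬⇒¬Any u∉ (subst (_∈ v ∷ t) (sym u≡w) (lastOf-∈ v t))) ⟩
    1 ∎
    where
    open ≡-Reasoning
    w = lastOf v t

  #canonical-double : (k : ℕ) → #canonical (suc k) ℕ.+ #canonical (suc k) ≡ n P suc (suc k)
  #canonical-double k = begin
    #canonical (suc k) ℕ.+ #canonical (suc k)
      ≡⟨ cong (#canonical (suc k) ℕ.+_) (sumOver-distinctSeqs-opposite (suc k) (𝟙 ∘ canonical)) ⟨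
    #canonical (suc k) ℕ.+ ∑[ s ∈ distinctSeqs n (suc k) ] 𝟙 (canonical (map opposite s))
      ≡⟨ sumOver-distrib-+ _ _ (distinctSeqs n (suc k)) ⟨
    ∑[ s ∈ distinctSeqs n (suc k) ] (𝟙 (canonical s) ℕ.+ 𝟙 (canonical (map opposite s)))
      ≡⟨ sumOver-congᴬ (All.map (λ {s} (uniq , len) → canonical-xor-opposite s uniq (subst (2 ℕ.≤_) (sym len) 2≤2+k))
                                (distinctSeqs-unique (suc k))) ⟩
    ∑[ s ∈ distinctSeqs n (suc k) ] 1
      ≡⟨ trans (sumOver-const 1 (distinctSeqs n (suc k))) (ℕ.*-identityʳ _) ⟩
    length (distinctSeqs n (suc k))
      ≡⟨ length-distinctSeqs (suc k) ⟩
    n P suc (suc k) ∎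
    where
    open ≡-Reasoning
    2≤2+k : 2 ℕ.≤ suc (suc k)
    2≤2+k = s≤s (s≤s z≤n)

joins : {n : ℕ} → Fin n × Fin n → Fin n × Fin n → Bool
joins (u , v) (a , b) = (eqF a u ∧ eqF b v) ∨ (eqF a v ∧ eqF b u)

adj≡any-joins : {n : ℕ} (G : Graph n) (u v : Fin n) → adj G u v ≡ any (joins (u , v)) G
adj≡any-joins [] u v = refl
adj≡any-joins ((a , b) ∷ G) u v = cong (joins (u , v) (a , b) ∨_) (adj≡any-joins G u v)

joins⇒ : {n : ℕ} {u v a b : Fin n} → joins (u , v) (a , b) ≡ true → (a ≡ u × b ≡ v) ⊎ (a ≡ v × b ≡ u)
joins⇒ {u = u} {v} {a} {b} hit =
  Sum.map both both (Equivalence.to (T-∨ {eqF a u ∧ eqF b v}) (Equivalence.from T-≡ hit))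
  where
  both : ∀ {x y z w} → T (eqF x y ∧ eqF z w) → x ≡ y × z ≡ w
  both {x} {y} {z} {w} t = let t₁ , t₂ = Equivalence.to (T-∧ {eqF x y}) t in toWitness t₁ , toWitness t₂

edges : {n : ℕ} → List (Fin n) → List (Fin n × Fin n)
edges [] = []
edges (u ∷ []) = []
edges (u ∷ v ∷ s) = (u , v) ∷ edges (v ∷ s)

length-edges : {n : ℕ} (s : List (Fin n)) → length (edges s) ≡ ℕ.pred (length s)
length-edges [] = refl
length-edges (u ∷ []) = refl
length-edges (u ∷ v ∷ s) = cong suc (length-edges (v ∷ s))

edges-≢ : {n : ℕ} (s : List (Fin n)) → Unique s → All (λ e → proj₁ e ≢ proj₂ e) (edges s)
edges-≢ [] _ = []
edges-≢ (u ∷ []) _ = []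
edges-≢ (u ∷ v ∷ s) ((u≢v ∷ _) ∷ uniq) = u≢v ∷ edges-≢ (v ∷ s) uniq

edges-∈ : {n : ℕ} (s : List (Fin n)) → All (λ e → proj₁ e ∈ s × proj₂ e ∈ s) (edges s)
edges-∈ [] = []
edges-∈ (u ∷ []) = []
edges-∈ (u ∷ v ∷ s) = (here refl , there (here refl)) ∷ All.map (λ (a∈ , b∈) → there a∈ , there b∈) (edges-∈ (v ∷ s))

module _ {n : ℕ} where
  open Coverage (joins {n})

  consecAdj≡allCovered : (G : Graph n) (s : List (Fin n)) → consecAdj G s ≡ allCovered (edges s) G
  consecAdj≡allCovered G [] = refl
  consecAdj≡allCovered G (u ∷ []) = refl
  consecAdj≡allCovered G (u ∷ v ∷ s) = cong₂ _∧_ (adj≡any-joins G u v) (consecAdj≡allCovered G (v ∷ s))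

  -- Every edge of v ∷ t has both ends in v ∷ t, so it cannot be the pair joined by u ∉ v ∷ t.
  ∉-edges-missed : (u v : Fin n) (t : List (Fin n)) (x : Fin n × Fin n) → u ∉ v ∷ t → joins (u , v) x ≡ true →
                   All (λ e → joins e x ≡ false) (edges (v ∷ t))
  ∉-edges-missed u v t (a , b) u∉ hit = All.map (λ {e} → missed e) (edges-∈ (v ∷ t))
    where
    u∈ab : a ≡ u ⊎ b ≡ u
    u∈ab = Sum.map proj₁ proj₂ (joins⇒ {u = u} {v} {a} {b} hit)
    missed : (e : Fin n × Fin n) → proj₁ e ∈ v ∷ t × proj₂ e ∈ v ∷ t → joins e (a , b) ≡ false
    missed (c , d) (c∈ , d∈) with joins (c , d) (a , b) in hit′
    ... | false = refl
    ... | true with joins⇒ {u = c} {d} {a} {b} hit′ | u∈ab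
    ...   | inj₁ (refl , _) | inj₁ refl = ⊥-elim (u∉ c∈)
    ...   | inj₁ (_ , refl) | inj₂ refl = ⊥-elim (u∉ d∈)
    ...   | inj₂ (refl , _) | inj₁ refl = ⊥-elim (u∉ d∈)
    ...   | inj₂ (_ , refl) | inj₂ refl = ⊥-elim (u∉ c∈)

  #coveredBy-edges≤1 : (x : Fin n × Fin n) (s : List (Fin n)) → Unique s → #coveredBy (edges s) x ℕ.≤ 1
  #coveredBy-edges≤1 x [] _ = z≤n
  #coveredBy-edges≤1 x (u ∷ []) _ = z≤n
  #coveredBy-edges≤1 x (u ∷ v ∷ t) (u∉ ∷ uniq) with joins (u , v) x in hit
  ... | false = #coveredBy-edges≤1 x (v ∷ t) uniq
  ... | true = ℕ.≤-reflexive (cong suc (missed⇒#coveredBy≡0 x (∉-edges-missed u v t x (All¬⇒¬Any u∉) hit)))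

  #coverers-pairs : (u v : Fin n) → u ≢ v → #coverers (pairs n) (u , v) ≡ 1
  #coverers-pairs u v u≢v = begin
    ∑[ x ∈ pairs n ] 𝟙 (joins (u , v) x)
      ≡⟨ trans (sumOver-concatMap _ _ (allFin n)) (sumOver-allFin n _) ⟩
    ∑[ i < n ] ∑[ x ∈ concatMap (pairsFrom i) (allFin n) ] 𝟙 (joins (u , v) x)
      ≡⟨ sum-cong-≗ {n} (λ i → trans (sumOver-concatMap _ _ (allFin n)) (sumOver-allFin n _)) ⟩
    ∑[ i < n ] ∑[ j < n ] ∑[ x ∈ pairsFrom i j ] 𝟙 (joins (u , v) x)
      ≡⟨ sum-cong-≗ {n} (λ i → trans (sum-cong-≗ {n} (λ j → trans (sumOver-pairsFrom i j (lt i j)) (split i j)))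
                                     (∑-distrib-+ {n} _ _)) ⟩
    ∑[ i < n ] (∑[ j < n ] at u v i j ℕ.+ ∑[ j < n ] at v u i j)
      ≡⟨ ∑-distrib-+ {n} _ _ ⟩
    ∑[ i < n ] ∑[ j < n ] at u v i j ℕ.+ ∑[ i < n ] ∑[ j < n ] at v u i j
      ≡⟨ cong₂ ℕ._+_ (∑∑-if-eqF u v _) (∑∑-if-eqF v u _) ⟩
    𝟙 (lt u v) ℕ.+ 𝟙 (lt v u)
      ≡⟨ <-xor-> u v u≢v ⟩
    1 ∎
    where
    open ≡-Reasoning
    lt : Fin n → Fin n → Bool
    lt i j = ⌊ toℕ i ℕ.<? toℕ j ⌋
    pairsFrom : Fin n → Fin n → List (Fin n × Fin n)
    pairsFrom i j = if lt i j then (i , j) ∷ [] else []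
    at : Fin n → Fin n → Fin n → Fin n → ℕ
    at a b i j = if eqF i a then (if eqF j b then 𝟙 (lt a b) else 0) else 0
    sumOver-pairsFrom : (i j : Fin n) (b : Bool) →
      ∑[ x ∈ (if b then (i , j) ∷ [] else []) ] 𝟙 (joins (u , v) x) ≡ (if b then 𝟙 (joins (u , v) (i , j)) else 0)
    sumOver-pairsFrom i j true = ℕ.+-identityʳ _
    sumOver-pairsFrom i j false = refl
    if0 : (b : Bool) → (if b then 0 else 0) ≡ 0
    if0 true = refl
    if0 false = refl
    if1 : (b : Bool) → (if b then 1 else 0) ≡ 𝟙 b
    if1 true = refl
    if1 false = refl
    split : (i j : Fin n) → (if lt i j then 𝟙 (joins (u , v) (i , j)) else 0) ≡ at u v i j ℕ.+ at v u i j
    split i j with i Fin.≟ u | j Fin.≟ v | i Fin.≟ v | j Fin.≟ u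
    ... | yes refl | yes refl | yes u≡v | _ = ⊥-elim (u≢v u≡v)
    ... | yes refl | yes refl | no _ | _ = trans (if1 (lt i j)) (sym (ℕ.+-identityʳ _))
    ... | yes refl | no _ | yes u≡v | _ = ⊥-elim (u≢v u≡v)
    ... | yes refl | no _ | no _ | _ = if0 (lt i j)
    ... | no _ | _ | yes refl | yes refl = if1 (lt i j)
    ... | no _ | _ | yes refl | no _ = if0 (lt i j)
    ... | no _ | _ | no _ | _ = if0 (lt i j)

  expect-isPathSeq : (p : ℚ) (k : ℕ) (s : List (Fin n)) → Unique s → length s ≡ suc k →
                     ℚ∑.∑[ G ∈ allGraphs n ] (prob p G * ℚ∑.𝟙 (isPathSeq G s)) ≡ ℚ∑.𝟙 (canonical s) * (p ^ℚ k)
  expect-isPathSeq p k s uniq len = begin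
    ℚ∑.∑[ G ∈ allGraphs n ] (prob p G * ℚ∑.𝟙 (isPathSeq G s))
      ≡⟨ ℚ∑.sumOver-cong factor (allGraphs n) ⟩
    ℚ∑.∑[ G ∈ allGraphs n ] ((subsetProb p (pairs n) G * ℚ∑.𝟙 (allCovered (edges s) G)) * ℚ∑.𝟙 (canonical s))
      ≡⟨ ℚ∑.*-distribʳ-sumOver (ℚ∑.𝟙 (canonical s)) _ (allGraphs n) ⟨
    coverProb p (pairs n) (edges s) * ℚ∑.𝟙 (canonical s)
      ≡⟨ cong (_* ℚ∑.𝟙 (canonical s)) (coverProb-exactCover p (pairs n) (edges s) once atMostOnce) ⟩
    (p ^ℚ length (edges s)) * ℚ∑.𝟙 (canonical s)
      ≡⟨ cong (λ m → (p ^ℚ m) * ℚ∑.𝟙 (canonical s)) (trans (length-edges s) (cong ℕ.pred len)) ⟩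
    (p ^ℚ k) * ℚ∑.𝟙 (canonical s)
      ≡⟨ ℚ.*-comm (p ^ℚ k) _ ⟩
    ℚ∑.𝟙 (canonical s) * (p ^ℚ k) ∎
    where
    open ≡-Reasoning
    -- prob p G unfolds to subsetProb p (pairs n) G.
    factor : (G : Graph n) → prob p G * ℚ∑.𝟙 (isPathSeq G s)
                           ≡ (subsetProb p (pairs n) G * ℚ∑.𝟙 (allCovered (edges s) G)) * ℚ∑.𝟙 (canonical s)
    factor G = begin
      prob p G * ℚ∑.𝟙 (consecAdj G s ∧ canonical s)
        ≡⟨ cong (prob p G *_) (ℚ∑.𝟙-∧ (consecAdj G s) (canonical s)) ⟩
      prob p G * (ℚ∑.𝟙 (consecAdj G s) * ℚ∑.𝟙 (canonical s))
        ≡⟨ cong (λ b → prob p G * (ℚ∑.𝟙 b * ℚ∑.𝟙 (canonical s))) (consecAdj≡allCovered G s) ⟩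
      prob p G * (ℚ∑.𝟙 (allCovered (edges s) G) * ℚ∑.𝟙 (canonical s))
        ≡⟨ ℚ.*-assoc (prob p G) _ _ ⟨
      (subsetProb p (pairs n) G * ℚ∑.𝟙 (allCovered (edges s) G)) * ℚ∑.𝟙 (canonical s) ∎
    once : All (λ e → #coverers (pairs n) e ≡ 1) (edges s)
    once = All.map (λ {e} → #coverers-pairs (proj₁ e) (proj₂ e)) (edges-≢ s uniq)
    atMostOnce : All (λ x → #coveredBy (edges s) x ℕ.≤ 1) (pairs n)
    atMostOnce = All.universal (λ x → #coveredBy-edges≤1 x s uniq) (pairs n)

toℚ≡mkℚ : (a : ℕ) → toℚ a ≡ mkℚ (ℤ.+ a) 0 (Coprime.sym (Coprime.1-coprimeTo a))
toℚ≡mkℚ a = ℚ.normalize-coprime (Coprime.sym (Coprime.1-coprimeTo a))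

toℚ-+ : (a b : ℕ) → toℚ (a ℕ.+ b) ≡ toℚ a + toℚ b
toℚ-+ a b rewrite toℚ≡mkℚ a | toℚ≡mkℚ b =
  ℚ./-cong {p₁ = ℤ.+ (a ℕ.+ b)} (sym (cong₂ ℤ._+_ (ℤ.*-identityʳ (ℤ.+ a)) (ℤ.*-identityʳ (ℤ.+ b)))) refl

toℚ-𝟙 : (b : Bool) → toℚ (𝟙 b) ≡ ℚ∑.𝟙 b
toℚ-𝟙 true = refl
toℚ-𝟙 false = refl

toℚ-sumOver : {X : Set} (f : X → ℕ) (xs : List X) → toℚ (sumOver f xs) ≡ ℚ∑.∑[ x ∈ xs ] toℚ (f x)
toℚ-sumOver f [] = refl
toℚ-sumOver f (x ∷ xs) = trans (toℚ-+ (f x) (sumOver f xs)) (cong (toℚ (f x) +_) (toℚ-sumOver f xs))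

sumℚ-map : {X : Set} (f : X → ℚ) (xs : List X) → sumℚ (map f xs) ≡ ℚ∑.sumOver f xs
sumℚ-map f [] = refl
sumℚ-map f (x ∷ xs) = cong (f x +_) (sumℚ-map f xs)

length-filter : {X : Set} (b : X → Bool) (xs : List X) →
                length (filter (λ x → b x Bool.≟ true) xs) ≡ ∑[ x ∈ xs ] 𝟙 (b x)
length-filter b [] = refl
length-filter b (x ∷ xs) with b x
... | true = cong suc (length-filter b xs)
... | false = length-filter b xs

sumFrom1-suc : (m : ℕ) (φ : ℕ → ℚ) → sumFrom1 (suc m) φ ≡ φ 1 + sumFrom1 m (φ ∘ suc)
sumFrom1-suc zero φ = trans (ℚ.+-identityˡ (φ 1)) (sym (ℚ.+-identityʳ (φ 1)))
sumFrom1-suc (suc m) φ = trans (cong (_+ φ (suc (suc m))) (sumFrom1-suc m φ)) (ℚ.+-assoc (φ 1) _ _)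

sumFrom1-cong : (m : ℕ) {φ ψ : ℕ → ℚ} → (∀ k → φ (suc k) ≡ ψ (suc k)) → sumFrom1 m φ ≡ sumFrom1 m ψ
sumFrom1-cong zero φ≗ψ = refl
sumFrom1-cong (suc m) φ≗ψ = cong₂ _+_ (sumFrom1-cong m φ≗ψ) (φ≗ψ m)

*-distribˡ-sumFrom1 : (m : ℕ) (a : ℚ) (φ : ℕ → ℚ) → a * sumFrom1 m φ ≡ sumFrom1 m (λ k → a * φ k)
*-distribˡ-sumFrom1 zero a φ = ℚ.*-zeroʳ a
*-distribˡ-sumFrom1 (suc m) a φ = trans (ℚ.*-distribˡ-+ a _ _) (cong (_+ a * φ (suc m)) (*-distribˡ-sumFrom1 m a φ))

sumOver-applyUpTo : (g : ℕ → ℚ) (f : ℕ → ℕ) (m : ℕ) →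
                    ℚ∑.∑[ k ∈ applyUpTo f m ] g k ≡ sumFrom1 m (λ k → g (f (k ∸ 1)))
sumOver-applyUpTo g f zero = refl
sumOver-applyUpTo g f (suc m) =
  trans (cong (g (f 0) +_) (trans (sumOver-applyUpTo g (f ∘ suc) m) (sumFrom1-cong m (λ k → refl))))
        (sym (sumFrom1-suc m (λ k → g (f (k ∸ 1)))))

module Expectation (n : ℕ) (p : ℚ) where
  open DistinctSeqs n
  open CanonicalSeqs n

  expect-pathSeqs : (k : ℕ) → ℚ∑.∑[ s ∈ distinctSeqs n k ] ℚ∑.∑[ G ∈ allGraphs n ] (prob p G * ℚ∑.𝟙 (isPathSeq G s))
                              ≡ toℚ (#canonical k) * (p ^ℚ k)
  expect-pathSeqs k = begin
    ℚ∑.∑[ s ∈ distinctSeqs n k ] ℚ∑.∑[ G ∈ allGraphs n ] (prob p G * ℚ∑.𝟙 (isPathSeq G s))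
      ≡⟨ ℚ∑.sumOver-congᴬ (All.map (λ {s} (uniq , len) → expect-isPathSeq p k s uniq len) (distinctSeqs-unique k)) ⟩
    ℚ∑.∑[ s ∈ distinctSeqs n k ] (ℚ∑.𝟙 (canonical s) * (p ^ℚ k))
      ≡⟨ ℚ∑.*-distribʳ-sumOver (p ^ℚ k) (ℚ∑.𝟙 ∘ canonical) (distinctSeqs n k) ⟨
    ℚ∑.∑[ s ∈ distinctSeqs n k ] ℚ∑.𝟙 (canonical s) * (p ^ℚ k)
      ≡⟨ cong (_* (p ^ℚ k)) (trans (ℚ∑.sumOver-cong (sym ∘ toℚ-𝟙 ∘ canonical) (distinctSeqs n k))
                                   (sym (toℚ-sumOver (𝟙 ∘ canonical) (distinctSeqs n k)))) ⟩
    toℚ (#canonical k) * (p ^ℚ k) ∎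
    where open ≡-Reasoning

  expect-pn : expect n p (λ G → toℚ (pn G)) ≡ sumFrom1 n (λ k → toℚ (#canonical (k ∸ 1)) * (p ^ℚ (k ∸ 1)))
  expect-pn = begin
    sumℚ (map (λ G → prob p G * toℚ (pn G)) (allGraphs n))
      ≡⟨ sumℚ-map _ (allGraphs n) ⟩
    ℚ∑.∑[ G ∈ allGraphs n ] (prob p G * toℚ (pn G))
      ≡⟨ ℚ∑.sumOver-cong (λ G → trans (cong (prob p G *_) (pn-as-sum G)) (ℚ∑.*-distribˡ-sumOver (prob p G) _ seqs))
                         (allGraphs n) ⟩
    ℚ∑.∑[ G ∈ allGraphs n ] ℚ∑.∑[ s ∈ seqs ] (prob p G * ℚ∑.𝟙 (isPathSeq G s))
      ≡⟨ ℚ∑.sumOver-comm _ (allGraphs n) seqs ⟩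
    ℚ∑.∑[ s ∈ seqs ] ℚ∑.∑[ G ∈ allGraphs n ] (prob p G * ℚ∑.𝟙 (isPathSeq G s))
      ≡⟨ ℚ∑.sumOver-concatMap _ (distinctSeqs n) (upTo n) ⟩
    ℚ∑.∑[ k ∈ upTo n ] ℚ∑.∑[ s ∈ distinctSeqs n k ] ℚ∑.∑[ G ∈ allGraphs n ] (prob p G * ℚ∑.𝟙 (isPathSeq G s))
      ≡⟨ ℚ∑.sumOver-cong expect-pathSeqs (upTo n) ⟩
    ℚ∑.∑[ k ∈ upTo n ] (toℚ (#canonical k) * (p ^ℚ k))
      ≡⟨ sumOver-applyUpTo (λ k → toℚ (#canonical k) * (p ^ℚ k)) id n ⟩
    sumFrom1 n (λ k → toℚ (#canonical (k ∸ 1)) * (p ^ℚ (k ∸ 1))) ∎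
    where
    open ≡-Reasoning
    seqs = allDistinctSeqs n
    pn-as-sum : (G : Graph n) → toℚ (pn G) ≡ ℚ∑.∑[ s ∈ seqs ] ℚ∑.𝟙 (isPathSeq G s)
    pn-as-sum G = trans (cong toℚ (length-filter (isPathSeq G) seqs))
                        (trans (toℚ-sumOver _ seqs) (ℚ∑.sumOver-cong (toℚ-𝟙 ∘ isPathSeq G) seqs))

toℚ-#canonical-suc : (n j : ℕ) → toℚ (CanonicalSeqs.#canonical n (suc j)) ≡ ½ * toℚ (n P suc (suc j))
toℚ-#canonical-suc n j = begin
  toℚ c                     ≡⟨ ½*[x+x]≡x (toℚ c) ⟨
  ½ * (toℚ c + toℚ c)       ≡⟨ cong (½ *_) (toℚ-+ c c) ⟨
  ½ * toℚ (c ℕ.+ c)         ≡⟨ cong (λ m → ½ * toℚ m) (CanonicalSeqs.#canonical-double n j) ⟩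
  ½ * toℚ (n P suc (suc j)) ∎
  where
  open ≡-Reasoning
  c = CanonicalSeqs.#canonical n (suc j)
  ½*[x+x]≡x : (x : ℚ) → ½ * (x + x) ≡ x
  ½*[x+x]≡x = solve 1 (λ x → con ½ :* (x :+ x) := x) refl
    where open +-*-Solver

sumFrom1-#canonical : (n : ℕ) (p : ℚ) →
                      sumFrom1 n (λ k → toℚ (CanonicalSeqs.#canonical n (k ∸ 1)) * (p ^ℚ (k ∸ 1)))
                      ≡ ½ * sumFrom1 n (λ k → toℚ (n P k) * (p ^ℚ (k ∸ 1))) + toℚ n * ½
sumFrom1-#canonical zero p = refl
sumFrom1-#canonical n@(suc m) p = begin
  sumFrom1 n (λ k → term (k ∸ 1))
    ≡⟨ sumFrom1-suc m _ ⟩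
  toℚ (#canonical 0) * 1ℚ + sumFrom1 m term
    ≡⟨ cong₂ _+_ (cong (λ c → toℚ c * 1ℚ) #canonical-0) rest ⟩
  toℚ n * 1ℚ + ½ * S
    ≡⟨ regroup (toℚ n) S ⟩
  ½ * (toℚ n * 1ℚ + S) + toℚ n * ½
    ≡⟨ cong (λ c → ½ * (toℚ c * 1ℚ + S) + toℚ n * ½) (nP1≡n n) ⟨
  ½ * (toℚ (n P 1) * 1ℚ + S) + toℚ n * ½
    ≡⟨ cong (λ z → ½ * z + toℚ n * ½) (sumFrom1-suc m (λ k → toℚ (n P k) * (p ^ℚ (k ∸ 1)))) ⟨
  ½ * sumFrom1 n (λ k → toℚ (n P k) * (p ^ℚ (k ∸ 1))) + toℚ n * ½ ∎
  where
  open ≡-Reasoning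
  open CanonicalSeqs n
  term : ℕ → ℚ
  term j = toℚ (#canonical j) * (p ^ℚ j)
  S : ℚ
  S = sumFrom1 m (λ k → toℚ (n P suc k) * (p ^ℚ k))
  rest : sumFrom1 m term ≡ ½ * S
  rest = trans (sumFrom1-cong m halve) (sym (*-distribˡ-sumFrom1 m ½ _))
    where
    halve : (j : ℕ) → term (suc j) ≡ ½ * (toℚ (n P suc (suc j)) * (p ^ℚ suc j))
    halve j = trans (cong (_* (p ^ℚ suc j)) (toℚ-#canonical-suc n j)) (ℚ.*-assoc ½ (toℚ (n P suc (suc j))) (p ^ℚ suc j))
  regroup : (x z : ℚ) → x * 1ℚ + ½ * z ≡ ½ * (x * 1ℚ + z) + x * ½
  regroup = solve 2 (λ x z → x :* con 1ℚ :+ con ½ :* z := con ½ :* (x :* con 1ℚ :+ z) :+ x :* con ½) refl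
    where open +-*-Solver

-- The identity is polynomial in p.
mainTheorem9 : (n : ℕ) (p : ℚ) → 0ℚ ≤ p → p ≤ 1ℚ →
    expect n p (λ G → toℚ (pn G))
      ≡ ½ * sumFrom1 n (λ k → toℚ (n P k) * (p ^ℚ (k ∸ 1))) + toℚ n * ½
mainTheorem9 n p _ _ = begin
  expect n p (λ G → toℚ (pn G))
    ≡⟨ Expectation.expect-pn n p ⟩
  sumFrom1 n (λ k → toℚ (CanonicalSeqs.#canonical n (k ∸ 1)) * (p ^ℚ (k ∸ 1)))
    ≡⟨ sumFrom1-#canonical n p ⟩
  ½ * sumFrom1 n (λ k → toℚ (n P k) * (p ^ℚ (k ∸ 1))) + toℚ n * ½ ∎
  where open ≡-Reasoning
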